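{- (Fixed Point Theorem) Let $n\geq0$ and $m\geq n+2$. Then $L_n^{n+1}=L_n^m$, i.e. for every set of formulas $\Gamma\cup\{\alpha\}$, $\Gamma\vdash_{L_n^{n+1}}\alpha$ iff $\Gamma\vdash_{L_n^m}\alpha$.
   Context: Formulas are built from propositional variables using unary $\neg,\circ$ and binary $\land,\lor,\to$; $\circ^0\alpha=\alpha$, $\circ^{m+1}\alpha=\circ\circ^m\alpha$, $\alpha\leftrightarrow\beta:=(\alpha\to\beta)\land(\beta\to\alpha)$. Logics are Hilbert calculi with modus ponens as only rule and axiom schemas. mbC has the positive classical axioms $\alpha\to(\beta\to\alpha)$; $(\alpha\to\beta)\to((\alpha\to(\beta\to\gamma))\to(\alpha\to\gamma))$; $\alpha\to(\beta\to(\alpha\land\beta))$; $(\alpha\land\beta)\to\alpha$; $(\alpha\land\beta)\to\beta$; $\alpha\to(\alpha\lor\beta)$; $\beta\to(\alpha\lor\beta)$; $(\alpha\to\gamma)\to((\beta\to\gamma)\to((\alpha\lor\beta)\to\gamma))$; $\alpha\lor(\alpha\to\beta)$; plus $\alpha\lor\neg\alpha$ and $\circ\alpha\to(\alpha\to(\neg\alpha\to\beta))$. mbCciw = mbC + $\circ\alpha\lor(\alpha\land\neg\alpha)$. $L_n^0$ = mbCciw + $\circ^{n+2}\alpha$; $L_n^1$ = $L_n^0$ + $\neg\neg\alpha\leftrightarrow\alpha$; for $k\geq2$, $L_n^k$ = $L_n^1$ + (ip$^j$) $\neg\circ^j\neg\alpha\leftrightarrow\neg\circ^j\alpha$ for all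 $1\leq j<k$. -}

module Defs where

open import Data.Nat using (ℕ; zero; suc; _+_; _≤_; _<_)

infixr 5 _⇒_
infixr 6 _∨'_
infixr 7 _∧'_

data Form : Set where
  var   : ℕ → Form
  ¬'_   : Form → Form
  ∘'_   : Form → Form
  _∧'_  : Form → Form → Form
  _∨'_  : Form → Form → Form
  _⇒_   : Form → Form → Form

∘^ : ℕ → Form → Form
∘^ zero    α = α
∘^ (suc m) α = ∘' (∘^ m α)

_⇔'_ : Form → Form → Form
α ⇔' β = (α ⇒ β) ∧' (β ⇒ α)

data MbCAx : Form → Set where
  ax1  : ∀ α β → MbCAx (α ⇒ (β ⇒ α))
  ax2  : ∀ α β γ → MbCAx ((α ⇒ β) ⇒ ((α ⇒ (β ⇒ γ)) ⇒ (α ⇒ γ)))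
  ax3  : ∀ α β → MbCAx (α ⇒ (β ⇒ (α ∧' β)))
  ax4  : ∀ α β → MbCAx ((α ∧' β) ⇒ α)
  ax5  : ∀ α β → MbCAx ((α ∧' β) ⇒ β)
  ax6  : ∀ α β → MbCAx (α ⇒ (α ∨' β))
  ax7  : ∀ α β → MbCAx (β ⇒ (α ∨' β))
  ax8  : ∀ α β γ → MbCAx ((α ⇒ γ) ⇒ ((β ⇒ γ) ⇒ ((α ∨' β) ⇒ γ)))
  ax9  : ∀ α β → MbCAx (α ∨' (α ⇒ β))
  ax10 : ∀ α → MbCAx (α ∨' (¬' α))
  bc1  : ∀ α β → MbCAx ((∘' α) ⇒ (α ⇒ ((¬' α) ⇒ β)))

data LAx (n k : ℕ) : Form → Set where
  mbc : ∀ {φ} → MbCAx φ → LAx n k φ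
  ciw : ∀ α → LAx n k ((∘' α) ∨' (α ∧' (¬' α)))
  bcn : ∀ α → LAx n k (∘^ (n + 2) α)
  cf  : 1 ≤ k → ∀ α → LAx n k ((¬' (¬' α)) ⇔' α)
  ip  : ∀ j → 1 ≤ j → j < k → ∀ α →
        LAx n k ((¬' (∘^ j (¬' α))) ⇔' (¬' (∘^ j α)))

data Derives (n k : ℕ) (Γ : Form → Set) : Form → Set where
  hyp : ∀ {φ} → Γ φ → Derives n k Γ φ
  ax  : ∀ {φ} → LAx n k φ → Derives n k Γ φ
  mp  : ∀ {φ ψ} → Derives n k Γ φ → Derives n k Γ (φ ⇒ ψ) → Derives n k Γ ψ

{-# OPTIONS --safe #-}
module Submission where

-- In L_n^{n+1} one derives, by simultaneous induction on j, both ∘^{j+1}¬α ↔ ∘^{j+1}α and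
-- ip^{j+1}. By ciw, ∘ψ → ∘ψ' holds as soon as ψ' → ψ and ¬ψ' → ¬ψ, so the equivalence at
-- level j+2 follows from the equivalence and ip at level j+1 (level 1 uses ¬¬α ↔ α). For
-- j < n, ip^{j+1} is an axiom; for j ≥ n, ∘^{j+2}β is an instance of the axiom ∘^{n+2}, so
-- ∘^{j+1}β is consistent and ¬ reverses the equivalence ∘^{j+1}¬α ↔ ∘^{j+1}α. Thus every
-- axiom of every L_n^m is a theorem of L_n^{n+1}, and the converse inclusion is monotonicity.

open import Defs
open import Data.Nat using (ℕ; zero; suc; _+_; _≤_; _<_; s≤s; z≤n)
open import Data.Nat.Properties
  using (+-comm; ≤-trans; ≤-reflexive; <-≤-trans; n<1+n; m<m+n; <-≤-connex; m≤n⇒∃[o]m+o≡n)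
open import Data.Product using (_×_; _,_)
open import Data.Sum using (_⊎_; inj₁; inj₂)
open import Relation.Binary.PropositionalEquality using (_≡_; refl; sym; cong; subst)

infixl 5 _,,_
_,,_ : (Form → Set) → Form → (Form → Set)
(Γ ,, φ) ψ = Γ ψ ⊎ ψ ≡ φ

∘^-+ : ∀ a b x → ∘^ (a + b) x ≡ ∘^ a (∘^ b x)
∘^-+ zero    b x = refl
∘^-+ (suc a) b x = cong ∘'_ (∘^-+ a b x)

module Hilbert {n k : ℕ} where

  infix 3 _⊢_
  _⊢_ : (Form → Set) → Form → Set
  _⊢_ = Derives n k

  infixl 4 _·_
  _·_ : ∀ {Γ φ ψ} → Γ ⊢ φ ⇒ ψ → Γ ⊢ φ → Γ ⊢ ψ
  f · x = mp x f

  weaken : ∀ {Γ φ ψ} → Γ ⊢ φ → Γ ,, ψ ⊢ φ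
  weaken (hyp h)  = hyp (inj₁ h)
  weaken (ax a)   = ax a
  weaken (mp d e) = mp (weaken d) (weaken e)

  here : ∀ {Γ φ} → Γ ,, φ ⊢ φ
  here = hyp (inj₂ refl)

  there : ∀ {Γ φ ψ} → Γ ,, φ ,, ψ ⊢ φ
  there = hyp (inj₁ (inj₂ refl))

  K : ∀ {Γ} α β → Γ ⊢ α ⇒ β ⇒ α
  K α β = ax (mbc (ax1 α β))

  S : ∀ {Γ} α β γ → Γ ⊢ (α ⇒ β) ⇒ (α ⇒ β ⇒ γ) ⇒ α ⇒ γ
  S α β γ = ax (mbc (ax2 α β γ))

  ⇒-refl : ∀ {Γ} φ → Γ ⊢ φ ⇒ φ
  ⇒-refl φ = S φ (φ ⇒ φ) φ · K φ φ · K φ (φ ⇒ φ)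

  deduction : ∀ {Γ φ ψ} → Γ ,, φ ⊢ ψ → Γ ⊢ φ ⇒ ψ
  deduction (hyp (inj₁ h))    = K _ _ · hyp h
  deduction (hyp (inj₂ refl)) = ⇒-refl _
  deduction (ax a)            = K _ _ · ax a
  deduction (mp d e)          = S _ _ _ · deduction d · deduction e

  ⇒-trans : ∀ {Γ φ ψ χ} → Γ ⊢ φ ⇒ ψ → Γ ⊢ ψ ⇒ χ → Γ ⊢ φ ⇒ χ
  ⇒-trans f g = deduction (weaken g · (weaken f · here))

  ∧-projˡ : ∀ {Γ} φ ψ → Γ ⊢ φ ∧' ψ ⇒ φ
  ∧-projˡ φ ψ = ax (mbc (ax4 φ ψ))

  ∧-projʳ : ∀ {Γ} φ ψ → Γ ⊢ φ ∧' ψ ⇒ ψ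
  ∧-projʳ φ ψ = ax (mbc (ax5 φ ψ))

  ∧-elimˡ : ∀ {Γ φ ψ} → Γ ⊢ φ ∧' ψ → Γ ⊢ φ
  ∧-elimˡ d = ∧-projˡ _ _ · d

  ∧-elimʳ : ∀ {Γ φ ψ} → Γ ⊢ φ ∧' ψ → Γ ⊢ ψ
  ∧-elimʳ d = ∧-projʳ _ _ · d

  ∧-intro : ∀ {Γ φ ψ} → Γ ⊢ φ → Γ ⊢ ψ → Γ ⊢ φ ∧' ψ
  ∧-intro d e = ax (mbc (ax3 _ _)) · d · e

  ∨-elim : ∀ {Γ φ ψ χ} → Γ ⊢ φ ⇒ χ → Γ ⊢ ψ ⇒ χ → Γ ⊢ φ ∨' ψ → Γ ⊢ χ
  ∨-elim f g d = ax (mbc (ax8 _ _ _)) · f · g · d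

  explosion : ∀ {Γ φ χ} → Γ ⊢ ∘' φ → Γ ⊢ φ → Γ ⊢ ¬' φ → Γ ⊢ χ
  explosion c d e = ax (mbc (bc1 _ _)) · c · d · e

  ∘-antitone-on-contradiction : ∀ {Γ ψ ψ'} →
    Γ ⊢ ψ' ∧' ¬' ψ' ⇒ ψ → Γ ⊢ ψ' ∧' ¬' ψ' ⇒ ¬' ψ → Γ ⊢ ∘' ψ ⇒ ∘' ψ'
  ∘-antitone-on-contradiction {Γ} {ψ} {ψ'} f g =
    deduction (∨-elim (⇒-refl _) contradiction-case (ax (ciw ψ')))
    where
    contradiction-case : Γ ,, ∘' ψ ⊢ ψ' ∧' ¬' ψ' ⇒ ∘' ψ'
    contradiction-case = deduction (explosion there (weaken (weaken f) · here) (weaken (weaken g) · here))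

  ∘-antitone : ∀ {Γ ψ ψ'} → Γ ⊢ ψ' ⇒ ψ → Γ ⊢ ¬' ψ' ⇒ ¬' ψ → Γ ⊢ ∘' ψ ⇒ ∘' ψ'
  ∘-antitone f g = ∘-antitone-on-contradiction (⇒-trans (∧-projˡ _ _) f) (⇒-trans (∧-projʳ _ _) g)

  ¬-antitone-below-∘ : ∀ {Γ ψ ψ'} → Γ ⊢ ∘' ψ → Γ ⊢ ψ' ⇒ ψ → Γ ⊢ ¬' ψ ⇒ ¬' ψ'
  ¬-antitone-below-∘ {ψ' = ψ'} c f =
    deduction (∨-elim (deduction (explosion (weaken (weaken c)) (weaken (weaken f) · here) there))
                      (⇒-refl _)
                      (ax (mbc (ax10 ψ'))))

open Hilbert

LAx-mono : ∀ {n k k' φ} → k ≤ k' → LAx n k φ → LAx n k' φ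
LAx-mono k≤k' (mbc a)          = mbc a
LAx-mono k≤k' (ciw α)          = ciw α
LAx-mono k≤k' (bcn α)          = bcn α
LAx-mono k≤k' (cf 1≤k α)       = cf (≤-trans 1≤k k≤k') α
LAx-mono k≤k' (ip j 1≤j j<k α) = ip j 1≤j (<-≤-trans j<k k≤k') α

Derives-replace-axioms : ∀ {n k k' Γ φ} →
  (∀ {ψ} → LAx n k ψ → Derives n k' Γ ψ) → Derives n k Γ φ → Derives n k' Γ φ
Derives-replace-axioms axioms (hyp h)  = hyp h
Derives-replace-axioms axioms (ax a)   = axioms a
Derives-replace-axioms axioms (mp d e) = mp (Derives-replace-axioms axioms d) (Derives-replace-axioms axioms e)

Derives-mono : ∀ {n k k' Γ φ} → k ≤ k' → Derives n k Γ φ → Derives n k' Γ φ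
Derives-mono k≤k' = Derives-replace-axioms (λ a → ax (LAx-mono k≤k' a))

module FixedPoint {n k : ℕ} (n<k : n < k) where

  1≤k : 1 ≤ k
  1≤k = ≤-trans (s≤s z≤n) n<k

  ∘^-derivable : ∀ {Γ i} x → n + 2 ≤ i → Derives n k Γ (∘^ i x)
  ∘^-derivable {Γ} x n+2≤i with m≤n⇒∃[o]m+o≡n n+2≤i
  ... | o , refl = subst (Derives n k Γ) (sym (∘^-+ (n + 2) o x)) (ax (bcn (∘^ o x)))

  ¬¬-elim : ∀ {Γ} α → Derives n k Γ (¬' ¬' α ⇒ α)
  ¬¬-elim α = ∧-elimˡ (ax (cf 1≤k α))

  ¬¬-intro : ∀ {Γ} α → Derives n k Γ (α ⇒ ¬' ¬' α)
  ¬¬-intro α = ∧-elimʳ (ax (cf 1≤k α))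

  ∘^-¬⇔ : ∀ {Γ} j α → Derives n k Γ (∘^ (suc j) (¬' α) ⇔' ∘^ (suc j) α)
  ¬∘^-¬⇔ : ∀ {Γ} j α → Derives n k Γ ((¬' ∘^ (suc j) (¬' α)) ⇔' (¬' ∘^ (suc j) α))

  ∘^-¬⇔ zero α =
    ∧-intro (∘-antitone-on-contradiction (∧-projʳ _ _) (deduction (¬¬-intro α · ∧-elimˡ here)))
            (∘-antitone-on-contradiction (deduction (¬¬-elim α · ∧-elimʳ here)) (∧-projˡ _ _))
  ∘^-¬⇔ (suc j) α =
    ∧-intro (∘-antitone (∧-elimʳ (∘^-¬⇔ j α)) (∧-elimʳ (¬∘^-¬⇔ j α)))
            (∘-antitone (∧-elimˡ (∘^-¬⇔ j α)) (∧-elimˡ (¬∘^-¬⇔ j α)))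

  ¬∘^-¬⇔ j α with <-≤-connex j n
  ... | inj₁ j<n = ax (ip (suc j) (s≤s z≤n) (≤-trans (s≤s j<n) n<k) α)
  ... | inj₂ n≤j =
    ∧-intro (¬-antitone-below-∘ (∘^-derivable (¬' α) n+2≤j+2) (∧-elimʳ (∘^-¬⇔ j α)))
            (¬-antitone-below-∘ (∘^-derivable α n+2≤j+2) (∧-elimˡ (∘^-¬⇔ j α)))
    where
    n+2≤j+2 : n + 2 ≤ 2 + j
    n+2≤j+2 = ≤-trans (≤-reflexive (+-comm n 2)) (s≤s (s≤s n≤j))

  axioms-derivable : ∀ {Γ m φ} → LAx n m φ → Derives n k Γ φ
  axioms-derivable (mbc a)            = ax (mbc a)
  axioms-derivable (ciw α)            = ax (ciw α)
  axioms-derivable (bcn α)            = ax (bcn α)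
  axioms-derivable (cf _ α)           = ax (cf 1≤k α)
  axioms-derivable (ip (suc j) _ _ α) = ¬∘^-¬⇔ j α

theorem28 : (n m : ℕ) → n + 2 ≤ m → (Γ : Form → Set) (α : Form) →
    (Derives n (suc n) Γ α → Derives n m Γ α) × (Derives n m Γ α → Derives n (suc n) Γ α)
theorem28 n m n+2≤m Γ α =
  Derives-mono (<-≤-trans (m<m+n n (s≤s z≤n)) n+2≤m) ,
  Derives-replace-axioms (FixedPoint.axioms-derivable (n<1+n n))
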